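{- For every graph $G$ and every $d\in\mathbb{N}$, we have $\chi_{\mathrm{sub}}(G^d)\leq \mathrm{wcol}_{2d}(G)$.
   Context: All graphs are finite, simple and undirected. $G^d$ is the graph on $V(G)$ where distinct $u,v$ are adjacent iff their distance in $G$ is at most $d$. The subchromatic index $\chi_{\mathrm{sub}}(H)$ of a graph $H$ is the least integer $c$ such that $V(H)$ can be colored with $c$ colors so that each color class induces a disjoint union of complete graphs. For a vertex ordering (linear order) $\sigma$ of $G$, $r\in\mathbb{N}$, and vertices $v\leq_\sigma u$, $v$ is weakly $r$-reachable from $u$ if there is a path of length at most $r$ from $u$ to $v$ all of whose vertices are not placed before $v$ in $\sigma$; $\mathrm{WReach}_r[G,\sigma,u]$ is the set of such $v$ (including $u$); $\mathrm{wcol}_r(G,\sigma)=\max_u|\mathrm{WReach}_r[G,\sigma,u]|$ and $\mathrm{wcol}_r(G)=\min_\sigma \mathrm{wcol}_r(G,\sigma)$. -}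

module Defs where

open import Data.Nat using (ℕ; zero; suc; _≤_; _*_)
open import Data.Fin using (Fin)
open import Data.Bool using (Bool; false; T)
open import Data.List using (List; []; _∷_; length)
open import Data.List.Membership.Propositional using (_∈_)
open import Data.List.Relation.Unary.All using (All)
open import Data.List.Relation.Unary.Unique.Propositional using (Unique)
open import Data.Product using (Σ; _×_; ∃)
open import Data.Sum using (_⊎_)
open import Relation.Binary.PropositionalEquality using (_≡_; _≢_)
open import Function.Definitions using (Injective)

record Graph (n : ℕ) : Set where
  field
    adj    : Fin n → Fin n → Bool
    sym    : ∀ u v → adj u v ≡ adj v u
    irrefl : ∀ u → adj u u ≡ false

open Graph public

Adj : ∀ {n} → Graph n → Fin n → Fin n → Set
Adj G u v = T (adj G u v)

-- Walk G u v ℓ vs : vs is the vertex sequence of a walk of length ℓ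
-- (ℓ edges) from u to v in G.
data Walk {n : ℕ} (G : Graph n) : Fin n → Fin n → ℕ → List (Fin n) → Set where
  here : ∀ u → Walk G u u zero (u ∷ [])
  step : ∀ {u w v ℓ vs} → Adj G u w → Walk G w v ℓ vs → Walk G u v (suc ℓ) (u ∷ vs)

Path : ∀ {n} → Graph n → Fin n → Fin n → ℕ → List (Fin n) → Set
Path G u v ℓ vs = Walk G u v ℓ vs × Unique vs

DistAtMost : ∀ {n} → Graph n → ℕ → Fin n → Fin n → Set
DistAtMost {n} G d u v = Σ ℕ λ ℓ → Σ (List (Fin n)) λ vs → Path G u v ℓ vs × ℓ ≤ d

PowAdj : ∀ {n} → Graph n → ℕ → Fin n → Fin n → Set
PowAdj G d u v = (u ≢ v) × DistAtMost G d u v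

-- c is a subcolouring w.r.t. adjacency relation E: in each colour class the
-- relation "equal or adjacent" is transitive, i.e. each colour class induces a
-- disjoint union of complete graphs.
IsSubcoloring : ∀ {n k} → (Fin n → Fin n → Set) → (Fin n → Fin k) → Set
IsSubcoloring {n} E c =
  ∀ (u v w : Fin n) → c u ≡ c v → c v ≡ c w →
    (u ≡ v ⊎ E u v) → (v ≡ w ⊎ E v w) → (u ≡ w ⊎ E u w)

SubchromaticAtMost : ∀ {n} → (Fin n → Fin n → Set) → ℕ → Set
SubchromaticAtMost {n} E k = Σ (Fin n → Fin k) (IsSubcoloring E)

-- A linear order σ on Fin n, given by an injective position map:
-- v ≤σ u iff pos v ≤ pos u.
record Ordering (n : ℕ) : Set where
  field
    pos    : Fin n → ℕ
    inj    : Injective _≡_ _≡_ pos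

open Ordering public

WReach : ∀ {n} → Graph n → Ordering n → ℕ → Fin n → Fin n → Set
WReach {n} G σ r u v =
  pos σ v ≤ pos σ u ×
  (Σ ℕ λ ℓ → Σ (List (Fin n)) λ vs →
     Path G u v ℓ vs × ℓ ≤ r × All (λ w → pos σ v ≤ pos σ w) vs)

WReachSizeAtMost : ∀ {n} → Graph n → Ordering n → ℕ → Fin n → ℕ → Set
WReachSizeAtMost {n} G σ r u k =
  Σ (List (Fin n)) λ xs → length xs ≤ k × (∀ v → WReach G σ r u v → v ∈ xs)

WcolAtMost : ∀ {n} → Graph n → ℕ → ℕ → Set
WcolAtMost {n} G r k = Σ (Ordering n) λ σ → ∀ u → WReachSizeAtMost G σ r u k

-- Let r = ⌊d/2⌋ and send every vertex u to its center p(u), the σ-least vertex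
-- within distance r of u. Color greedily along σ, giving each vertex a color
-- not used by the earlier vertices weakly 2d-reachable from it; this needs at
-- most wcol_{2d}(G) colors. Give u the color of p(u). If dist(u,v) ≤ d and
-- p(u) <σ p(v), then the walk p(v) ⇝ v ⇝ u ⇝ p(u) has length ≤ 2d and, since
-- d ≤ 2r+1, each of its vertices lies within distance r of u or of v and so
-- does not precede p(u): p(u) is weakly 2d-reachable from p(v), and the two
-- centers get different colors. Hence within a color class vertices at
-- distance ≤ d share their center, and vertices sharing a center are at
-- distance ≤ 2r ≤ d, so the relation "equal or adjacent in G^d" is transitive.
module Submission where

open import Defs hiding (sym)
open import Data.Nat using (ℕ; zero; suc; _+_; _*_; _≤_; _<_; z≤n; s≤s; _≤?_; _<?_)
open import Data.Nat.Properties
open import Data.Fin using (Fin; toℕ)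
import Data.Fin.Properties as Fin
open import Data.Bool using (T)
open import Data.Bool.Properties using (T?)
open import Data.List using (List; []; _∷_; length; map; filter; allFin; lookup; drop)
open import Data.List.Properties using (length-map; filter-notAll; map-cong-local)
open import Data.List.Membership.Propositional using (_∈_; _∉_)
open import Data.List.Membership.Propositional.Properties
  using (∈-filter⁺; ∈-filter⁻; ∈-map⁺; ∈-allFin)
import Data.List.Membership.DecPropositional as DecMembership
open import Data.List.Relation.Unary.Any as Any using (here; there)
open import Data.List.Relation.Unary.Any.Properties using (lookup-index)
open import Data.List.Relation.Unary.All as All using (All; []; _∷_)
open import Data.List.Relation.Unary.All.Properties using (¬Any⇒All¬; all-filter; drop⁺)
import Data.List.Relation.Unary.Unique.Propositional.Properties as Unique
open import Data.List.Relation.Unary.AllPairs using ([]; _∷_)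
open import Data.List.Extrema.Nat using (argmin; argmin-all; f[argmin]≤f[xs])
open import Data.Product using (Σ; ∃; ∃₂; _×_; _,_; proj₁; proj₂)
open import Data.Sum using (inj₁; inj₂; [_,_])
open import Data.Empty using (⊥-elim; ⊥-elim-irr)
open import Data.Unit using (tt)
open import Function using (_∘_)
open import Level using (0ℓ)
open import Relation.Nullary using (yes; no)
open import Relation.Nullary.Decidable using (Dec; _×-dec_; decidable-stable)
open import Relation.Unary using (Pred; U; _⊆_; _∪_)
open import Relation.Binary.Definitions using (tri<; tri≈; tri>)
open import Relation.Binary.PropositionalEquality
  using (_≡_; _≢_; refl; sym; trans; cong; subst; module ≡-Reasoning)

halve : ∀ d → ∃ λ r → r + r ≤ d × d ≤ suc (r + r)
halve zero = 0 , z≤n , z≤n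
halve (suc zero) = 0 , z≤n , s≤s z≤n
halve (suc (suc d)) with r , 2r≤d , d≤2r+1 ← halve d =
  suc r , s≤s (≤-trans (≤-reflexive (+-suc r r)) (s≤s 2r≤d))
        , s≤s (≤-trans (s≤s d≤2r+1) (≤-reflexive (cong suc (sym (+-suc r r)))))

module _ {k : ℕ} where
  open DecMembership (Fin._≟_ {k}) using (_∈?_; _∉?_)

  covering⇒length≥ : (cs : List (Fin k)) → (∀ c → c ∈ cs) → k ≤ length cs
  covering⇒length≥ cs covers = Fin.injective⇒≤ λ {i} {j} eq → begin
    i                                  ≡⟨ lookup-index (covers i) ⟩
    lookup cs (Any.index (covers i))   ≡⟨ cong (lookup cs) eq ⟩
    lookup cs (Any.index (covers j))   ≡⟨ lookup-index (covers j) ⟨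
    j                                  ∎
    where open ≡-Reasoning

  fresh-color : (cs : List (Fin k)) → .(length cs < k) → ∃ (_∉ cs)
  fresh-color cs short with Fin.any? (_∉? cs)
  ... | yes found = found
  ... | no none = ⊥-elim-irr (<⇒≱ short (covering⇒length≥ cs λ c →
                    decidable-stable (c ∈? cs) (λ c∉cs → none (c , c∉cs))))

  fresh-color-cong : ∀ {cs cs′} .{p q} → cs ≡ cs′ →
                      proj₁ (fresh-color cs p) ≡ proj₁ (fresh-color cs′ q)
  fresh-color-cong refl = refl

module GreedyColoring {A : Set} (h : A → ℕ) (N : A → List A)
  (N-earlier : ∀ {x y} → x ∈ N y → h x < h y)
  {k : ℕ} (N-short : ∀ y → length (N y) < k) where

  -- Recursion on a fuel f; the color is determined as soon as f > h y, and the
  -- value at fuel 0 is never used.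
  colorWithin : ℕ → A → Fin k
  colorWithin zero y = proj₁ (fresh-color [] (≤-<-trans z≤n (N-short y)))
  colorWithin (suc f) y = proj₁ (fresh-color (map (colorWithin f) (N y))
    (subst (_< k) (sym (length-map (colorWithin f) (N y))) (N-short y)))

  colorWithin-stable : ∀ {f f′} y → h y < f → h y < f′ →
                        colorWithin f y ≡ colorWithin f′ y
  colorWithin-stable {suc f} {suc f′} y hy<f hy<f′ =
    fresh-color-cong (map-cong-local (All.tabulate λ {x} x∈Ny →
      colorWithin-stable x (<-≤-trans (N-earlier x∈Ny) (≤-pred hy<f))
                            (<-≤-trans (N-earlier x∈Ny) (≤-pred hy<f′))))

  color : A → Fin k
  color y = colorWithin (suc (h y)) y

  color-proper : ∀ {x y} → x ∈ N y → color x ≢ color y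
  color-proper {x} {y} x∈Ny eq =
    proj₂ (fresh-color (map (colorWithin (h y)) (N y))
            (subst (_< k) (sym (length-map (colorWithin (h y)) (N y))) (N-short y)))
          (subst (_∈ map (colorWithin (h y)) (N y)) same (∈-map⁺ (colorWithin (h y)) x∈Ny))
    where
    same : colorWithin (h y) x ≡ color y
    same = trans (colorWithin-stable x (N-earlier x∈Ny) (n<1+n (h x))) eq

module _ {n : ℕ} (G : Graph n) where

  data WalkIn (Q : Pred (Fin n) 0ℓ) : Fin n → Fin n → ℕ → Set where
    nil  : ∀ {u} → Q u → WalkIn Q u u 0
    cons : ∀ {u w v ℓ} → Q u → Adj G u w → WalkIn Q w v ℓ → WalkIn Q u v (suc ℓ)

  Walk′ : Fin n → Fin n → ℕ → Set
  Walk′ = WalkIn U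

  private variable
    Q R : Pred (Fin n) 0ℓ
    u v w : Fin n
    ℓ m : ℕ

  mapʷ : Q ⊆ R → WalkIn Q u v ℓ → WalkIn R u v ℓ
  mapʷ f (nil q) = nil (f q)
  mapʷ f (cons q e rest) = cons (f q) e (mapʷ f rest)

  _++ʷ_ : WalkIn Q u v ℓ → WalkIn Q v w m → WalkIn Q u w (ℓ + m)
  nil _ ++ʷ rest = rest
  cons q e walk ++ʷ rest = cons q e (walk ++ʷ rest)

  snocʷ : WalkIn Q u v ℓ → Adj G v w → Q w → WalkIn Q u w (suc ℓ)
  snocʷ (nil q) e q′ = cons q e (nil q′)
  snocʷ (cons q e walk) e′ q′ = cons q e (snocʷ walk e′ q′)

  reverseʷ : WalkIn Q u v ℓ → WalkIn Q v u ℓ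
  reverseʷ (nil q) = nil q
  reverseʷ {u = u} (cons {w = w} q e walk) =
    snocʷ (reverseʷ walk) (subst T (Graph.sym G u w) e) q

  walk⇒walkʷ : ∀ {vs} → Walk G u v ℓ vs → Walk′ u v ℓ
  walk⇒walkʷ (here u) = nil tt
  walk⇒walkʷ (step e walk) = cons tt e (walk⇒walkʷ walk)

  suffix-walk : ∀ {vs} → Walk G w v ℓ vs → (u∈vs : u ∈ vs) →
                ∃ λ ℓ′ → ℓ′ ≤ ℓ × Walk G u v ℓ′ (drop (toℕ (Any.index u∈vs)) vs)
  suffix-walk (here w) (here refl) = 0 , z≤n , here w
  suffix-walk (step e walk) (here refl) = _ , ≤-refl , step e walk
  suffix-walk (step e walk) (there u∈vs) with ℓ′ , ℓ′≤ℓ , suffix ← suffix-walk walk u∈vs =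
    ℓ′ , m≤n⇒m≤1+n ℓ′≤ℓ , suffix

  walkIn⇒path : WalkIn Q u v ℓ →
                ∃₂ λ ℓ′ vs → Path G u v ℓ′ vs × ℓ′ ≤ ℓ × All Q vs
  walkIn⇒path (nil {u} q) = 0 , u ∷ [] , (here u , [] ∷ []) , z≤n , q ∷ []
  walkIn⇒path {u = u} (cons q e rest)
    with ℓ′ , vs , (walk , unique) , ℓ′≤ℓ , qs ← walkIn⇒path rest
       | DecMembership._∈?_ Fin._≟_ u vs
  ... | yes u∈vs with ℓ″ , ℓ″≤ℓ′ , suffix ← suffix-walk walk u∈vs =
    let i = toℕ (Any.index u∈vs) in
    ℓ″ , drop i vs , (suffix , Unique.drop⁺ i unique)
       , m≤n⇒m≤1+n (≤-trans ℓ″≤ℓ′ ℓ′≤ℓ) , drop⁺ i qs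
  ... | no u∉vs =
    suc ℓ′ , u ∷ vs , (step e walk , ¬Any⇒All¬ vs u∉vs ∷ unique) , s≤s ℓ′≤ℓ , q ∷ qs

  Ball : ℕ → Fin n → Pred (Fin n) 0ℓ
  Ball r c y = ∃ λ ℓ → ℓ ≤ r × Walk′ c y ℓ

  ball? : ∀ r c y → Dec (Ball r c y)
  ball? zero c y with c Fin.≟ y
  ... | yes refl = yes (0 , z≤n , nil tt)
  ... | no c≢y = no λ { (_ , _ , nil _) → c≢y refl ; (_ , () , cons _ _ _) }
  ball? (suc r) c y with c Fin.≟ y | Fin.any? (λ w → T? (adj G c w) ×-dec ball? r w y)
  ... | yes refl | _ = yes (0 , z≤n , nil tt)
  ... | no _ | yes (w , e , ℓ , ℓ≤r , w⇝y) = yes (suc ℓ , s≤s ℓ≤r , cons tt e w⇝y)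
  ... | no c≢y | no none = no λ
    { (_ , _ , nil _) → c≢y refl
    ; (suc ℓ , s≤s ℓ≤r , cons {w = w} _ e w⇝y) → none (w , e , ℓ , ℓ≤r , w⇝y) }

  Intermediate : ℕ → Fin n → Fin n → Pred (Fin n) 0ℓ
  Intermediate L a b z = ∃₂ λ i j → i + j ≤ L × Walk′ a z i × Walk′ z b j

  walk-intermediate : Walk′ u v ℓ → WalkIn (Intermediate ℓ u v) u v ℓ
  walk-intermediate walk = go (nil tt) walk ≤-refl
    where
    go : ∀ {a b c L} → Walk′ a c m → Walk′ c b ℓ → m + ℓ ≤ L →
         WalkIn (Intermediate L a b) c b ℓ
    go {m = m} before (nil q) le = nil (m , 0 , le , before , nil q)
    go {m = m} {ℓ = suc ℓ} {L = L} before (cons q e rest) le =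
      cons (m , suc ℓ , le , before , cons q e rest) e
           (go (snocʷ before e tt) rest (subst (_≤ L) (+-suc m ℓ) le))

  walk-within-ball : ∀ {r} → ℓ ≤ r → Walk′ u v ℓ → WalkIn (Ball r u) u v ℓ
  walk-within-ball ℓ≤r walk = mapʷ
    (λ { (i , j , i+j≤ℓ , u⇝z , _) → i , ≤-trans (m≤m+n i j) (≤-trans i+j≤ℓ ℓ≤r) , u⇝z })
    (walk-intermediate walk)

  walk-within-balls : ∀ {r} → ℓ ≤ suc (r + r) → Walk′ u v ℓ →
                      WalkIn (Ball r u ∪ Ball r v) u v ℓ
  walk-within-balls {r = r} ℓ≤ walk = mapʷ near-an-end (walk-intermediate walk)
    where
    near-an-end : Intermediate _ _ _ ⊆ (Ball r _ ∪ Ball r _)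
    near-an-end (i , j , i+j≤ℓ , u⇝z , z⇝v) with i ≤? r
    ... | yes i≤r = inj₁ (i , i≤r , u⇝z)
    ... | no i≰r = inj₂ (j , +-cancelˡ-≤ (suc r) j r
                           (≤-trans (+-monoˡ-≤ j (≰⇒> i≰r)) (≤-trans i+j≤ℓ ℓ≤))
                         , reverseʷ z⇝v)

  wreach-refl : ∀ σ r u → WReach G σ r u u
  wreach-refl σ r u = ≤-refl , 0 , u ∷ [] , (here u , [] ∷ []) , z≤n , ≤-refl ∷ []

  wreach-coloring : ∀ {r k} (σ : Ordering n) → (∀ u → WReachSizeAtMost G σ r u k) →
                     Σ (Fin n → Fin k) λ φ →
                       ∀ {u v} → WReach G σ r u v → pos σ v < pos σ u → φ v ≢ φ u
  wreach-coloring {r} {k} σ small = color , λ {u} {v} reach v<u →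
    color-proper (∈-filter⁺ (λ x → pos σ x <? pos σ u) (proj₂ (proj₂ (small u)) v reach) v<u)
    where
    earlier : Fin n → List (Fin n)
    earlier y = filter (λ x → pos σ x <? pos σ y) (proj₁ (small y))

    earlier-short : ∀ y → length (earlier y) < k
    earlier-short y = <-≤-trans
      (filter-notAll (λ x → pos σ x <? pos σ y) (proj₁ (small y))
        (Any.map (λ { refl → n≮n (pos σ y) }) (proj₂ (proj₂ (small y)) y (wreach-refl σ r y))))
      (proj₁ (proj₂ (small y)))

    open GreedyColoring (pos σ) earlier
      (λ {x} {y} x∈ → proj₂ (∈-filter⁻ (λ x → pos σ x <? pos σ y) {xs = proj₁ (small y)} x∈))
      earlier-short

  module Centres (σ : Ordering n) (r : ℕ) where

    ball-members : Fin n → List (Fin n)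
    ball-members u = filter (ball? r u) (allFin n)

    center : Fin n → Fin n
    center u = argmin (pos σ) u (ball-members u)

    center-in-ball : ∀ u → Ball r u (center u)
    center-in-ball u = argmin-all (pos σ) (0 , z≤n , nil tt) (all-filter (ball? r u) (allFin n))

    center-minimal : ∀ u → Ball r u ⊆ λ z → pos σ (center u) ≤ pos σ z
    center-minimal u {z} z∈ball = All.lookup (f[argmin]≤f[xs] u (ball-members u))
                                              (∈-filter⁺ (ball? r u) (∈-allFin z) z∈ball)

    ball-above-center : pos σ (center u) ≤ pos σ (center v) →
                        Ball r v ⊆ λ z → pos σ (center u) ≤ pos σ z
    ball-above-center {v = v} cu≤cv z∈ball = ≤-trans cu≤cv (center-minimal v z∈ball)

    center-reaches : ∀ {R} → ℓ ≤ suc (r + r) → r + (ℓ + r) ≤ R → Walk′ u v ℓ →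
                     pos σ (center u) < pos σ (center v) →
                     WReach G σ R (center v) (center u)
    center-reaches {ℓ} {u} {v} ℓ≤ bound u⇝v cu<cv
      with a , a≤r , v⇝cv ← center-in-ball v
         | b , b≤r , u⇝cu ← center-in-ball u
      with ℓ′ , vs , path , ℓ′≤ , above ← walkIn⇒path
             (mapʷ (ball-above-center (<⇒≤ cu<cv)) (reverseʷ (walk-within-ball a≤r v⇝cv))
          ++ʷ (mapʷ [ center-minimal u , ball-above-center (<⇒≤ cu<cv) ]
                    (reverseʷ (walk-within-balls ℓ≤ u⇝v))
          ++ʷ mapʷ (center-minimal u) (walk-within-ball b≤r u⇝cu))) =
      <⇒≤ cu<cv , ℓ′ , vs , path
                , ≤-trans ℓ′≤ (≤-trans (+-mono-≤ a≤r (+-monoʳ-≤ ℓ b≤r)) bound) , above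

    same-color⇒same-center : ∀ {R k} (φ : Fin n → Fin k) →
      (∀ {x y} → WReach G σ R y x → pos σ x < pos σ y → φ x ≢ φ y) →
      ℓ ≤ suc (r + r) → r + (ℓ + r) ≤ R → Walk′ u v ℓ →
      φ (center u) ≡ φ (center v) → center u ≡ center v
    same-color⇒same-center {u = u} {v} φ proper ℓ≤ bound walk same
      with <-cmp (pos σ (center u)) (pos σ (center v))
    ... | tri< cu<cv _ _ = ⊥-elim (proper (center-reaches ℓ≤ bound walk cu<cv) cu<cv same)
    ... | tri≈ _ cu≡cv _ = Ordering.inj σ cu≡cv
    ... | tri> _ _ cv<cu =
      ⊥-elim (proper (center-reaches ℓ≤ bound (reverseʷ walk) cv<cu) cv<cu (sym same))

    same-center⇒close : center u ≡ center v → DistAtMost G (r + r) u v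
    same-center⇒close {u} {v} cu≡cv
      with a , a≤r , u⇝cu ← center-in-ball u
         | b , b≤r , v⇝cv ← center-in-ball v
      with ℓ , vs , path , ℓ≤ , _ ← walkIn⇒path
             (u⇝cu ++ʷ subst (λ c → Walk′ c v b) (sym cu≡cv) (reverseʷ v⇝cv)) =
      ℓ , vs , path , ≤-trans ℓ≤ (+-mono-≤ a≤r b≤r)

    center-coloring-isSubcoloring : ∀ {d k} (φ : Fin n → Fin k) →
      r + r ≤ d → d ≤ suc (r + r) →
      (∀ {x y} → WReach G σ (2 * d) y x → pos σ x < pos σ y → φ x ≢ φ y) →
      IsSubcoloring (PowAdj G d) (φ ∘ center)
    center-coloring-isSubcoloring {d} φ 2r≤d d≤2r+1 proper = transitive
      where
      detour≤2d : ℓ ≤ d → r + (ℓ + r) ≤ 2 * d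
      detour≤2d {ℓ} ℓ≤d = begin
        r + (ℓ + r)   ≡⟨ +-comm r (ℓ + r) ⟩
        (ℓ + r) + r   ≡⟨ +-assoc ℓ r r ⟩
        ℓ + (r + r)   ≤⟨ +-mono-≤ ℓ≤d 2r≤d ⟩
        d + d         ≡⟨ cong (d +_) (+-identityʳ d) ⟨
        2 * d         ∎
        where open ≤-Reasoning

      share-center : φ (center u) ≡ φ (center v) → PowAdj G d u v → center u ≡ center v
      share-center same (_ , ℓ , _ , (walk , _) , ℓ≤d) = same-color⇒same-center φ proper
        (≤-trans ℓ≤d d≤2r+1) (detour≤2d ℓ≤d) (walk⇒walkʷ walk) same

      transitive : IsSubcoloring (PowAdj G d) (φ ∘ center)
      transitive u v w _ _ (inj₁ refl) v~w = v~w
      transitive u v w _ _ (inj₂ u~v) (inj₁ refl) = inj₂ u~v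
      transitive u v w uv vw (inj₂ u~v) (inj₂ v~w) with u Fin.≟ w
      ... | yes u≡w = inj₁ u≡w
      ... | no u≢w with ℓ , vs , path , ℓ≤ ← same-center⇒close
                          (trans (share-center uv u~v) (share-center vw v~w)) =
        inj₂ (u≢w , ℓ , vs , path , ≤-trans ℓ≤ 2r≤d)

theorem4p1 : ∀ {n} (G : Graph n) (d k : ℕ) →
    WcolAtMost G (2 * d) k → SubchromaticAtMost (PowAdj G d) k
theorem4p1 G d k (σ , wcol≤k) =
  let r , 2r≤d , d≤2r+1 = halve d
      φ , φ-proper = wreach-coloring G σ wcol≤k
      open Centres G σ r
  in φ ∘ center , center-coloring-isSubcoloring φ 2r≤d d≤2r+1 φ-proper
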